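{- Let $H$ and $K$ be finite groups with coprime orders, and let $\pi$ be the set of prime divisors of $|H|$. Then the directed $\pi$-excluded quotient power graph $\vec{\mathcal{Q}}_{ -\pi}(H\times K)$ is (isomorphic to) a disjoint union of copies of the directed quotient power graph $\vec{\mathcal{Q}}(K)$, with one copy for each cyclic subgroup of $H$.
   Context: For a group $G$, the directed quotient power graph $\vec{\mathcal{Q}}(G)$ has as vertex set the set of cyclic subgroups of $G$, with a directed edge from each cyclic subgroup $C$ to each proper subgroup $D$ of $C$ (such $D$ is itself cyclic); this edge is labeled by the index $|C:D|$. For a set $\mathcal{X}$ of integers greater than $1$, the directed $\mathcal{X}$-excluded quotient power graph $\vec{\mathcal{Q}}_{ -\mathcal{X}}(G)$ is the subgraph of $\vec{\mathcal{Q}}(G)$ (same vertex set) obtained by deleting every edge whose label is divisible by some element of $\mathcal{X}$. -}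

module Defs where

open import Level using (Level; _⊔_) renaming (suc to lsuc)
open import Data.Nat using (ℕ; zero; suc; _*_)
open import Data.Nat.Divisibility using (_∣_)
open import Data.Nat.Primality using (Prime)
open import Data.Integer using (ℤ; +_; -[1+_])
open import Data.Fin using (Fin)
open import Data.Product using (Σ; ∃; ∃-syntax; _×_; _,_; proj₁; proj₂)
open import Data.Product.Relation.Binary.Pointwise.NonDependent using (×-setoid)
open import Relation.Nullary using (¬_)
open import Relation.Binary using (Setoid; Rel)
import Relation.Binary.Construct.On as On
import Relation.Binary.PropositionalEquality as ≡
open import Function.Base using (id; _∘_)
open import Function.Bundles using (Inverse; Equivalence; _⇔_; mk⇔)
open import Algebra.Bundles using (Group)
import Algebra.Construct.DirectProduct as DP

private variable c ℓ c' ℓ' e e' : Level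

record FiniteGroup (c ℓ : Level) : Set (lsuc (c ⊔ ℓ)) where
  field
    group : Group c ℓ
    size  : ℕ
    enum  : Inverse (≡.setoid (Fin size)) (Group.setoid group)

_×ᴳ_ : Group c ℓ → Group c' ℓ' → Group (c ⊔ c') (ℓ ⊔ ℓ')
G ×ᴳ H = DP.group G H

record DiGraph (v ℓv e : Level) : Set (lsuc (v ⊔ ℓv ⊔ e)) where
  field
    Vertex : Setoid v ℓv
    Edge   : Rel (Setoid.Carrier Vertex) e

record _≅ᴳ_ {v ℓv e v' ℓv' e' : Level}
            (Γ : DiGraph v ℓv e) (Δ : DiGraph v' ℓv' e')
            : Set (v ⊔ ℓv ⊔ e ⊔ v' ⊔ ℓv' ⊔ e') where
  field
    vmap      : Inverse (DiGraph.Vertex Γ) (DiGraph.Vertex Δ)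
    edge-pres : ∀ x y → DiGraph.Edge Γ x y ⇔ DiGraph.Edge Δ (Inverse.to vmap x) (Inverse.to vmap y)

module _ (G : Group c ℓ) where
  open Group G

  _^ⁿ_ : Carrier → ℕ → Carrier
  g ^ⁿ zero  = ε
  g ^ⁿ suc n = g ∙ (g ^ⁿ n)

  _^ᶻ_ : Carrier → ℤ → Carrier
  g ^ᶻ (+ n)    = g ^ⁿ n
  g ^ᶻ -[1+ n ] = (g ⁻¹) ^ⁿ suc n

  _∈⟨_⟩ : Carrier → Carrier → Set ℓ
  x ∈⟨ g ⟩ = ∃[ k ] (g ^ᶻ k ≈ x)

  _⊆⟨⟩_ : Carrier → Carrier → Set (c ⊔ ℓ)
  h ⊆⟨⟩ g = ∀ x → x ∈⟨ h ⟩ → x ∈⟨ g ⟩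

  SameCyclic : Carrier → Carrier → Set (c ⊔ ℓ)
  SameCyclic g h = ∀ x → (x ∈⟨ g ⟩ ⇔ x ∈⟨ h ⟩)

  -- The vertex set: cyclic subgroups of G, each represented by a generator.
  CycSub : Setoid c (c ⊔ ℓ)
  CycSub = record
    { Carrier = Carrier
    ; _≈_ = SameCyclic
    ; isEquivalence = record
      { refl  = λ x → mk⇔ id id
      ; sym   = λ p x → mk⇔ (Equivalence.from (p x)) (Equivalence.to (p x))
      ; trans = λ p q x → mk⇔ (Equivalence.to (q x) ∘ Equivalence.to (p x))
                              (Equivalence.from (p x) ∘ Equivalence.from (q x)) } }

  ⟨_⟩ₛ : Carrier → Setoid (c ⊔ ℓ) ℓ
  ⟨ g ⟩ₛ = record
    { Carrier = Σ Carrier (λ x → x ∈⟨ g ⟩)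
    ; _≈_ = λ a b → proj₁ a ≈ proj₁ b
    ; isEquivalence = On.isEquivalence proj₁ isEquivalence }

  HasCard : Carrier → ℕ → Set (c ⊔ ℓ)
  HasCard g m = Inverse (≡.setoid (Fin m)) ⟨ g ⟩ₛ

  QEdge : Carrier → Carrier → Set (c ⊔ ℓ)
  QEdge g h = (h ⊆⟨⟩ g) × ¬ (g ⊆⟨⟩ h)

  -- the label |⟨ g ⟩ : ⟨ h ⟩| equals k  (index = |C| / |D|, i.e. |C| = k·|D|)
  Label : Carrier → Carrier → ℕ → Set (c ⊔ ℓ)
  Label g h k = ∃[ m ] ∃[ n ] (HasCard g m × HasCard h n × m ≡.≡ k * n)

  QPG : DiGraph c (c ⊔ ℓ) (c ⊔ ℓ)
  QPG = record { Vertex = CycSub ; Edge = QEdge }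

  QPGexcl : ∀ {x} → (ℕ → Set x) → DiGraph c (c ⊔ ℓ) (c ⊔ ℓ ⊔ x)
  QPGexcl X = record
    { Vertex = CycSub
    ; Edge = λ g h → QEdge g h × ∃[ k ] (Label g h k × (∀ p → X p → ¬ (p ∣ k))) }

⨆ : ∀ {i ℓi v ℓv e} (I : Setoid i ℓi) → DiGraph v ℓv e → DiGraph (i ⊔ v) (ℓi ⊔ ℓv) (ℓi ⊔ e)
⨆ I Γ = record
  { Vertex = ×-setoid I (DiGraph.Vertex Γ)
  ; Edge = λ a b → (Setoid._≈_ I (proj₁ a) (proj₁ b)) × DiGraph.Edge Γ (proj₂ a) (proj₂ b) }

primeDivisors : ∀ {c ℓ} → FiniteGroup c ℓ → ℕ → Set
primeDivisors H p = Prime p × (p ∣ FiniteGroup.size H)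

{-# OPTIONS --safe #-}
module Submission where

-- Every element order in H divides |H| (Lagrange for cyclic subgroups), and likewise in K, so
-- ord h and ord k are coprime and ⟨(h , k)⟩ = ⟨h⟩ × ⟨k⟩: the former embeds in the latter and both
-- have ord h · ord k elements.  Hence ⟨(h′ , k′)⟩ ⊆ ⟨(h , k)⟩ iff ⟨h′⟩ ⊆ ⟨h⟩ and ⟨k′⟩ ⊆ ⟨k⟩, and the
-- label of such an edge is |⟨h⟩ : ⟨h′⟩| · |⟨k⟩ : ⟨k′⟩|.  The first factor divides |H|, so excluding
-- the primes of |H| forces ⟨h′⟩ = ⟨h⟩; the second divides |K|, so it is never excluded.  The
-- surviving edges are therefore exactly the edges of Q(K) with the H-coordinate held fixed.

open import Level using (Level; _⊔_)
open import Defs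
open import Algebra.Bundles using (Group)
import Algebra.Definitions.RawMonoid as RawMonoidDefinitions
import Algebra.Properties.Group as GroupProperties
import Algebra.Properties.Monoid.Mult as MonoidMult
open import Data.Bool using (if_then_else_)
open import Data.Fin as F using (Fin; toℕ)
open import Data.Fin.Properties
  using ( any?; <-cmp; suc-injective; toℕ-injective; toℕ<n; toℕ-fromℕ<; punchOut-injective
        ; pigeonhole; injective⇒≤; cantor-schröder-bernstein; *↔× )
open import Data.Integer using (+_; -[1+_])
open import Data.List using ([]; _∷_)
open import Data.List.Relation.Unary.All using ([]; _∷_)
open import Data.Nat using (ℕ; zero; suc; _+_; _*_; _<_; _≤_; s≤s)
open import Data.Nat.Coprimality using (Coprime; coprime⇒gcd≡1)
open import Data.Nat.Divisibility
  using ( _∣_; divides; quotient; quotient-∣; m∣n⇒n≡quotient*m; m∣m*n; n∣m*n; _∣0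
        ; ∣-antisym; ∣-trans; m%n≡0⇒n∣m; >⇒∤ )
open import Data.Nat.DivMod using (_%_; _/_; m≡m%n+[m/n]*n; m%n<n)
open import Data.Nat.GCD using (gcd)
open import Data.Nat.LCM using (lcm; gcd*lcm; lcm-least; m∣lcm[m,n]; n∣lcm[m,n])
open import Data.Nat.ListAction using (product)
open import Data.Nat.Primality using (Prime; prime[2]; ¬prime[1])
open import Data.Nat.Primality.Factorisation using (factorise)
open import Data.Nat.Properties
  using ( *-comm; *-suc; *-identityˡ; +-suc; +-identityʳ; *-cancelʳ-≡; *-commutativeSemigroup
        ; 1+n≰n; n<1+n; m≤n+m; ≤-total; ≤-<-trans; m≤n⇒∃[o]m+o≡n )
open import Algebra.Properties.CommutativeSemigroup *-commutativeSemigroup using (interchange; x∙yz≈y∙xz)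
open import Data.Product using (∃; _×_; _,_; proj₁; proj₂; map; uncurry)
open import Data.Product.Function.NonDependent.Setoid using (_×-inverse_)
open import Data.Product.Relation.Binary.Pointwise.NonDependent using (_×ₛ_; Pointwise-≡↔≡)
open import Data.Sum using (inj₁; inj₂)
open import Function.Base using (_∘_; id)
open import Function.Bundles using (Inverse; Injection; Equivalence; _⇔_; mk⇔)
import Function.Construct.Composition as Comp
import Function.Construct.Symmetry as Sym
open import Function.Definitions using (Injective)
open import Function.Properties.Bijection using (Bijection⇒Inverse)
open import Function.Properties.Inverse using (Inverse⇒Injection)
open import Relation.Binary using (Setoid; Rel; tri<; tri≈; tri>)
import Relation.Binary.Reasoning.Setoid as SetoidReasoning
open import Relation.Binary.PropositionalEquality as ≡ using (_≡_)
open import Relation.Nullary using (¬_; Dec; does; yes; no; contradiction)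
import Relation.Nullary.Decidable as Dec
open import Relation.Unary using (Pred; Decidable)

private variable c₁ c₂ ℓ₁ ℓ₂ ℓp ℓq ℓr : Level

HasSize : Setoid c₁ ℓ₁ → ℕ → Set (c₁ ⊔ ℓ₁)
HasSize A n = Inverse (≡.setoid (Fin n)) A

Fin-injective⇒surjective : ∀ {n} {f : Fin n → Fin n} → Injective _≡_ _≡_ f → ∀ i → ∃ λ j → f j ≡ i
Fin-injective⇒surjective {suc n} {f} f-injective i with any? (λ j → f j F.≟ i)
... | yes hit = hit
... | no miss = contradiction (injective⇒≤ f′-injective) 1+n≰n
  where
  f′ : Fin (suc n) → Fin n
  f′ j = F.punchOut {i = i} (λ i≡fj → miss (j , ≡.sym i≡fj))

  f′-injective : Injective _≡_ _≡_ f′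
  f′-injective {j} {k} = f-injective ∘ punchOut-injective {i = i} _ _

module _ {A : Setoid c₁ ℓ₁} where

  size-unique : ∀ {m n} → HasSize A m → HasSize A n → m ≡ n
  size-unique eA eA′ = cantor-schröder-bernstein (injective eA eA′) (injective eA′ eA)
    where
    injective : ∀ {m n} (e : HasSize A m) (e′ : HasSize A n) →
                Injective _≡_ _≡_ (Inverse.from e′ ∘ Inverse.to e)
    injective e e′ =
      Injection.injective (Comp.injection (Inverse⇒Injection e) (Inverse⇒Injection (Sym.inverse e′)))

module _ {A : Setoid c₁ ℓ₁} {B : Setoid c₂ ℓ₂} where
  open Setoid B using (_≈_)

  injection⇒surjective : ∀ {n} → HasSize A n → HasSize B n → (f : Injection A B) →
                         ∀ y → ∃ λ x → Injection.to f x ≈ y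
  injection⇒surjective {n} eA eB f y = Inverse.to eA (proj₁ hit) , Injection.injective fromB (proj₂ hit)
    where
    fromB : Injection B (≡.setoid (Fin n))
    fromB = Inverse⇒Injection (Sym.inverse eB)

    roundTrip : Injection (≡.setoid (Fin n)) (≡.setoid (Fin n))
    roundTrip = Comp.injection (Inverse⇒Injection eA) (Comp.injection f fromB)

    hit : ∃ λ i → Injection.to roundTrip i ≡ Inverse.from eB y
    hit = Fin-injective⇒surjective (Injection.injective roundTrip) (Inverse.from eB y)

  ×-size : ∀ {m n} → HasSize A m → HasSize B n → HasSize (A ×ₛ B) (m * n)
  ×-size eA eB = Comp.inverse *↔× (Comp.inverse (Sym.inverse Pointwise-≡↔≡) (eA ×-inverse eB))


Least : ∀ {A : Set c₁} → Rel A ℓr → Pred A ℓp → Pred A (c₁ ⊔ ℓr ⊔ ℓp)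
Least _≺_ P x = P x × (∀ {y} → y ≺ x → ¬ P y)

least : ∀ {P : Pred ℕ ℓp} → Decidable P → ∀ n → P n → ∃ (Least _<_ P)
least P? zero    p0 = 0 , p0 , λ ()
least P? (suc n) pn with P? 0
... | yes p0 = 0 , p0 , λ ()
... | no ¬p0 with least (P? ∘ suc) n pn
...   | m , pm , below = suc m , pm , λ { {zero} _ → ¬p0 ; {suc k} (s≤s k<m) → below k<m }

leastFin : ∀ {n} {P : Pred (Fin n) ℓp} → Decidable P → ∃ P → ∃ (Least F._<_ P)
leastFin {n = suc n} P? (i , pi) with P? F.zero
... | yes p0 = F.zero , p0 , λ ()
leastFin P? (F.zero , p0) | no ¬p0 = contradiction p0 ¬p0
leastFin P? (F.suc i , pi) | no ¬p0 with leastFin (P? ∘ F.suc) (i , pi)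
... | r , pr , below = F.suc r , pr , λ { {F.zero} _ → ¬p0 ; {F.suc j} (s≤s j<r) → below j<r }

Least-unique : ∀ {n} {P : Pred (Fin n) ℓp} {Q : Pred (Fin n) ℓq} →
               (∀ {i} → P i → Q i) → (∀ {i} → Q i → P i) →
               ∀ {r s} → Least F._<_ P r → Least F._<_ Q s → r ≡ s
Least-unique P⇒Q Q⇒P {r} {s} (pr , r-least) (qs , s-least) with <-cmp r s
... | tri< r<s _ _ = contradiction (P⇒Q pr) (s-least r<s)
... | tri≈ _ r≡s _ = r≡s
... | tri> _ _ s<r = contradiction (Q⇒P qs) (r-least s<r)

count : ∀ {n} {P : Pred (Fin n) ℓp} → Decidable P → ℕ
count {n = zero} P? = 0
count {n = suc n} P? = if does (P? F.zero) then suc (count (P? ∘ F.suc)) else count (P? ∘ F.suc)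

select : ∀ {n} {P : Pred (Fin n) ℓp} (P? : Decidable P) → Fin (count P?) → Fin n
select {n = suc n} P? j with P? F.zero
select {n = suc n} P? F.zero     | yes _ = F.zero
select {n = suc n} P? (F.suc j)  | yes _ = F.suc (select (P? ∘ F.suc) j)
select {n = suc n} P? j          | no _  = F.suc (select (P? ∘ F.suc) j)

select-∈ : ∀ {n} {P : Pred (Fin n) ℓp} (P? : Decidable P) j → P (select P? j)
select-∈ {n = suc n} P? j with P? F.zero
select-∈ {n = suc n} P? F.zero    | yes p0 = p0
select-∈ {n = suc n} P? (F.suc j) | yes _  = select-∈ (P? ∘ F.suc) j
select-∈ {n = suc n} P? j         | no _   = select-∈ (P? ∘ F.suc) j

select-injective : ∀ {n} {P : Pred (Fin n) ℓp} (P? : Decidable P) → Injective _≡_ _≡_ (select P?)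
select-injective {n = suc n} P? {i} {j} eq with P? F.zero
select-injective {n = suc n} P? {F.zero}  {F.zero}  _  | yes _ = ≡.refl
select-injective {n = suc n} P? {F.suc i} {F.suc j} eq | yes _ =
  ≡.cong F.suc (select-injective (P? ∘ F.suc) (suc-injective eq))
select-injective {n = suc n} P? eq | no _ = select-injective (P? ∘ F.suc) (suc-injective eq)

select-surjective : ∀ {n} {P : Pred (Fin n) ℓp} (P? : Decidable P) {i} → P i → ∃ λ j → select P? j ≡ i
select-surjective {n = suc n} P? {i} pi with P? F.zero
select-surjective {n = suc n} P? {F.zero}  _  | yes _   = F.zero , ≡.refl
select-surjective {n = suc n} P? {F.suc i} pi | yes _   = map F.suc (≡.cong F.suc) (select-surjective (P? ∘ F.suc) pi)
select-surjective {n = suc n} P? {F.zero}  p0 | no ¬p0  = contradiction p0 ¬p0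
select-surjective {n = suc n} P? {F.suc i} pi | no _    = map id (≡.cong F.suc) (select-surjective (P? ∘ F.suc) pi)

coprime⇒lcm≡* : ∀ {m n} → Coprime m n → lcm m n ≡ m * n
coprime⇒lcm≡* {m} {n} coprime = begin
  lcm m n            ≡⟨ *-identityˡ (lcm m n) ⟨
  1 * lcm m n        ≡⟨ ≡.cong (_* lcm m n) (coprime⇒gcd≡1 coprime) ⟨
  gcd m n * lcm m n  ≡⟨ gcd*lcm m n ⟩
  m * n              ∎
  where open ≡.≡-Reasoning

no-prime-divisor⇒≡1 : ∀ {n} → (∀ {p} → Prime p → ¬ p ∣ n) → n ≡ 1
no-prime-divisor⇒≡1 {zero} none = contradiction (2 ∣0) (none prime[2])
no-prime-divisor⇒≡1 {suc n} none with factorise (suc n)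
... | record { factors = [] ; isFactorisation = n≡1 } = n≡1
... | record { factors = p ∷ ps ; isFactorisation = n≡p*Πps ; factorsPrime = p-prime ∷ _ } =
  contradiction (≡.subst (p ∣_) (≡.sym n≡p*Πps) (m∣m*n (product ps))) (none p-prime)

module CyclicSubgroups {c ℓ} (G : Group c ℓ) where
  open Group G
  open RawMonoidDefinitions rawMonoid using () renaming (_×_ to _·_)
  open MonoidMult monoid using (×-congʳ; ×-homo-+; ×-assocˡ; ×-idem)

  infixr 8 _^_
  _^_ : Carrier → ℕ → Carrier
  _^_ = _^ⁿ_ G

  ^≡· : ∀ g n → g ^ n ≡ n · g
  ^≡· g zero    = ≡.refl
  ^≡· g (suc n) = ≡.cong (g ∙_) (^≡· g n)

  ^-congˡ : ∀ {x y} n → x ≈ y → x ^ n ≈ y ^ n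
  ^-congˡ {x} {y} n x≈y rewrite ^≡· x n | ^≡· y n = ×-congʳ n x≈y

  ^-homo-+ : ∀ g m n → g ^ (m + n) ≈ g ^ m ∙ g ^ n
  ^-homo-+ g m n rewrite ^≡· g (m + n) | ^≡· g m | ^≡· g n = ×-homo-+ g m n

  ^-assoc : ∀ g m n → (g ^ m) ^ n ≈ g ^ (m * n)
  ^-assoc g m n rewrite ^≡· (g ^ m) n | ^≡· g m | ^≡· g (m * n) | *-comm m n = ×-assocˡ g n m

  ε^n≈ε : ∀ n → ε ^ n ≈ ε
  ε^n≈ε zero      = refl
  ε^n≈ε (suc n) rewrite ^≡· ε (suc n) = ×-idem (identityˡ ε) (suc n)

  ^∈⟨⟩ : ∀ g n → _∈⟨_⟩ G (g ^ n) g
  ^∈⟨⟩ g n = + n , refl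

  ∈⟨⟩-refl : ∀ g → _∈⟨_⟩ G g g
  ∈⟨⟩-refl g = + 1 , identityʳ g

  ∈⟨⟩-resp-≈ : ∀ {x y g} → x ≈ y → _∈⟨_⟩ G x g → _∈⟨_⟩ G y g
  ∈⟨⟩-resp-≈ x≈y (k , gᵏ≈x) = k , trans gᵏ≈x x≈y

  ⊆⟨⟩⇒∈⟨⟩ : ∀ {h g} → _⊆⟨⟩_ G h g → _∈⟨_⟩ G h g
  ⊆⟨⟩⇒∈⟨⟩ {h} h⊆g = h⊆g h (∈⟨⟩-refl h)

  ⊆⟨⟩-antisym : ∀ {g h} → _⊆⟨⟩_ G h g → _⊆⟨⟩_ G g h → SameCyclic G g h
  ⊆⟨⟩-antisym h⊆g g⊆h x = mk⇔ (g⊆h x) (h⊆g x)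

  SameCyclic⇒⊇ : ∀ {g h} → SameCyclic G g h → _⊆⟨⟩_ G h g
  SameCyclic⇒⊇ g≈h x = Equivalence.from (g≈h x)

  SameCyclic⇒⊆ : ∀ {g h} → SameCyclic G g h → _⊆⟨⟩_ G g h
  SameCyclic⇒⊆ g≈h x = Equivalence.to (g≈h x)

  inclusion : ∀ {h g} → _⊆⟨⟩_ G h g → Injection (⟨_⟩ₛ G h) (⟨_⟩ₛ G g)
  inclusion h⊆g = record { to = λ (x , x∈h) → x , h⊆g x x∈h ; cong = id ; injective = id }

module FiniteGroupProperties {c ℓ} (G : FiniteGroup c ℓ) where
  open FiniteGroup G
  open Group group
  open CyclicSubgroups group public
  open GroupProperties group using (identityʳ-unique; inverseʳ-unique)
  open SetoidReasoning setoid
  private module E = Inverse enum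

  to-injective : ∀ {i j} → E.to i ≈ E.to j → i ≡ j
  to-injective = Injection.injective (Inverse⇒Injection enum)

  from-injective : ∀ {x y} → E.from x ≡ E.from y → x ≈ y
  from-injective = Injection.injective (Inverse⇒Injection (Sym.inverse enum))

  infix 4 _≟_
  _≟_ : ∀ x y → Dec (x ≈ y)
  x ≟ y = Dec.map′ from-injective E.from-cong (E.from x F.≟ E.from y)

  ^≈^-+⇒^≈ε : ∀ g i k → g ^ i ≈ g ^ (i + k) → g ^ k ≈ ε
  ^≈^-+⇒^≈ε g i k gⁱ≈gⁱ⁺ᵏ = identityʳ-unique (g ^ i) (g ^ k) (begin
    g ^ i ∙ g ^ k  ≈⟨ ^-homo-+ g i k ⟨
    g ^ (i + k)    ≈⟨ gⁱ≈gⁱ⁺ᵏ ⟨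
    g ^ i          ∎)

  ∃-period : ∀ g → ∃ λ k → g ^ suc k ≈ ε
  ∃-period g with pigeonhole (n<1+n size) (λ (i : Fin (suc size)) → E.from (g ^ toℕ i))
  ... | i , j , i<j , same with m≤n⇒∃[o]m+o≡n i<j
  ... | k , i+1+k≡j = k , ^≈^-+⇒^≈ε g (toℕ i) (suc k)
          (trans (from-injective same) (reflexive (≡.cong (g ^_) (≡.sym (≡.trans (+-suc (toℕ i) k) i+1+k≡j)))))

  -- Opaque because the brute-force search must never be unfolded during unification.
  private opaque
    order : ∀ g → ∃ (Least _<_ (λ k → g ^ suc k ≈ ε))
    order g = uncurry (least (λ k → g ^ suc k ≟ ε)) (∃-period g)

  ord∸1 : Carrier → ℕ
  ord∸1 g = proj₁ (order g)

  ord : Carrier → ℕ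
  ord g = suc (ord∸1 g)

  ^ord≈ε : ∀ g → g ^ ord g ≈ ε
  ^ord≈ε g = proj₁ (proj₂ (order g))

  ⁻¹≈^ord∸1 : ∀ g → g ⁻¹ ≈ g ^ ord∸1 g
  ⁻¹≈^ord∸1 g = sym (inverseʳ-unique g (g ^ ord∸1 g) (^ord≈ε g))

  ord∣⇒^≈ε : ∀ g {n} → ord g ∣ n → g ^ n ≈ ε
  ord∣⇒^≈ε g (divides q ≡.refl) = begin
    g ^ (q * ord g)    ≡⟨ ≡.cong (g ^_) (*-comm q (ord g)) ⟩
    g ^ (ord g * q)    ≈⟨ ^-assoc g (ord g) q ⟨
    (g ^ ord g) ^ q    ≈⟨ ^-congˡ q (^ord≈ε g) ⟩
    ε ^ q              ≈⟨ ε^n≈ε q ⟩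
    ε                  ∎

  ^≈^%ord : ∀ g n → g ^ n ≈ g ^ (n % ord g)
  ^≈^%ord g n = begin
    g ^ n                                       ≡⟨ ≡.cong (g ^_) (m≡m%n+[m/n]*n n (ord g)) ⟩
    g ^ (n % ord g + n / ord g * ord g)         ≈⟨ ^-homo-+ g (n % ord g) (n / ord g * ord g) ⟩
    g ^ (n % ord g) ∙ g ^ (n / ord g * ord g)   ≈⟨ ∙-congˡ (ord∣⇒^≈ε g (n∣m*n (n / ord g))) ⟩
    g ^ (n % ord g) ∙ ε                         ≈⟨ identityʳ _ ⟩
    g ^ (n % ord g)                             ∎

  ^≈ε⇒ord∣ : ∀ g {n} → g ^ n ≈ ε → ord g ∣ n
  ^≈ε⇒ord∣ g {n} gⁿ≈ε with n % ord g in n%ord≡r | m%n<n n (ord g)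
  ... | zero  | _         = m%n≡0⇒n∣m n (ord g) n%ord≡r
  ... | suc k | s≤s k<ord∸1 = contradiction
          (trans (sym (trans (^≈^%ord g n) (reflexive (≡.cong (g ^_) n%ord≡r)))) gⁿ≈ε)
          (proj₂ (proj₂ (order g)) k<ord∸1)

  private
    ^-injective-≤ : ∀ g {i j} → i ≤ j → j < ord g → g ^ i ≈ g ^ j → i ≡ j
    ^-injective-≤ g {i} i≤j j<ord gⁱ≈gʲ with m≤n⇒∃[o]m+o≡n i≤j
    ... | zero  , i+0≡j  = ≡.trans (≡.sym (+-identityʳ i)) i+0≡j
    ... | suc k , ≡.refl = contradiction (^≈ε⇒ord∣ g (^≈^-+⇒^≈ε g i (suc k) gⁱ≈gʲ))
                                         (>⇒∤ (≤-<-trans (m≤n+m (suc k) i) j<ord))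

  ^-injective : ∀ g {i j} → i < ord g → j < ord g → g ^ i ≈ g ^ j → i ≡ j
  ^-injective g {i} {j} i<ord j<ord gⁱ≈gʲ with ≤-total i j
  ... | inj₁ i≤j = ^-injective-≤ g i≤j j<ord gⁱ≈gʲ
  ... | inj₂ j≤i = ≡.sym (^-injective-≤ g j≤i i<ord (sym gⁱ≈gʲ))

  ∈⟨⟩⇒^ : ∀ {x g} → _∈⟨_⟩ group x g → ∃ λ n → g ^ n ≈ x
  ∈⟨⟩⇒^ (+ n , gⁿ≈x) = n , gⁿ≈x
  ∈⟨⟩⇒^ {x} {g} (-[1+ n ] , g⁻ⁿ⁻¹≈x) = ord∸1 g * suc n , (begin
    g ^ (ord∸1 g * suc n)   ≈⟨ ^-assoc g (ord∸1 g) (suc n) ⟨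
    (g ^ ord∸1 g) ^ suc n   ≈⟨ ^-congˡ (suc n) (⁻¹≈^ord∸1 g) ⟨
    (g ⁻¹) ^ suc n          ≈⟨ g⁻ⁿ⁻¹≈x ⟩
    x                       ∎)

  ∈⟨⟩⇒^Fin : ∀ {x g} → _∈⟨_⟩ group x g → ∃ λ (i : Fin (ord g)) → g ^ toℕ i ≈ x
  ∈⟨⟩⇒^Fin {x} {g} x∈g = let n , gⁿ≈x = ∈⟨⟩⇒^ x∈g in
    F.fromℕ< (m%n<n n (ord g)) ,
    trans (reflexive (≡.cong (g ^_) (toℕ-fromℕ< (m%n<n n (ord g))))) (trans (sym (^≈^%ord g n)) gⁿ≈x)

  ∈⟨⟩⇒⊆⟨⟩ : ∀ {h g} → _∈⟨_⟩ group h g → _⊆⟨⟩_ group h g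
  ∈⟨⟩⇒⊆⟨⟩ {h} {g} h∈g x x∈h with ∈⟨⟩⇒^ h∈g | ∈⟨⟩⇒^ x∈h
  ... | a , gᵃ≈h | b , hᵇ≈x =
    ∈⟨⟩-resp-≈ (trans (^-congˡ b gᵃ≈h) hᵇ≈x) (∈⟨⟩-resp-≈ (sym (^-assoc g a b)) (^∈⟨⟩ g (a * b)))

  ∈⟨⟩⇒ord∣ : ∀ {h g} → _∈⟨_⟩ group h g → ord h ∣ ord g
  ∈⟨⟩⇒ord∣ {h} {g} h∈g = let a , gᵃ≈h = ∈⟨⟩⇒^ h∈g in ^≈ε⇒ord∣ h (begin
    h ^ ord g          ≈⟨ ^-congˡ (ord g) gᵃ≈h ⟨
    (g ^ a) ^ ord g    ≈⟨ ^-assoc g a (ord g) ⟩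
    g ^ (a * ord g)    ≈⟨ ord∣⇒^≈ε g (n∣m*n a) ⟩
    ε                  ∎)

  SameCyclic⇒ord≡ : ∀ {g h} → SameCyclic group g h → ord g ≡ ord h
  SameCyclic⇒ord≡ g≈h =
    ∣-antisym (∈⟨⟩⇒ord∣ (⊆⟨⟩⇒∈⟨⟩ (SameCyclic⇒⊆ g≈h))) (∈⟨⟩⇒ord∣ (⊆⟨⟩⇒∈⟨⟩ (SameCyclic⇒⊇ g≈h)))

  HasCard-ord : ∀ g → HasCard group g (ord g)
  HasCard-ord g = Bijection⇒Inverse record
    { to        = λ i → g ^ toℕ i , ^∈⟨⟩ g (toℕ i)
    ; cong      = λ { ≡.refl → refl }
    ; bijective = (λ gⁱ≈gʲ → toℕ-injective (^-injective g (toℕ<n _) (toℕ<n _) gⁱ≈gʲ))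
                , λ (x , x∈g) → let i , gⁱ≈x = ∈⟨⟩⇒^Fin x∈g in i , λ { ≡.refl → gⁱ≈x }
    }

  ⊆⟨⟩∧ord≡⇒⊇ : ∀ {h g} → _⊆⟨⟩_ group h g → ord h ≡ ord g → _⊆⟨⟩_ group g h
  ⊆⟨⟩∧ord≡⇒⊇ {h} {g} h⊆g ord≡ =
    let (x , x∈h) , x≈g = injection⇒surjective (≡.subst (HasCard group h) ord≡ (HasCard-ord h))
                                               (HasCard-ord g) (inclusion h⊆g) (g , ∈⟨⟩-refl g)
    in ∈⟨⟩⇒⊆⟨⟩ (∈⟨⟩-resp-≈ x≈g x∈h)

module Lagrange {c ℓ} (G : FiniteGroup c ℓ) (g : Group.Carrier (FiniteGroup.group G)) where
  open FiniteGroup G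
  open Group group
  open FiniteGroupProperties G
  open GroupProperties group using (∙-cancelˡ)
  open SetoidReasoning setoid
  private module E = Inverse enum

  SameCoset : Carrier → Carrier → Set ℓ
  SameCoset x y = ∃ λ (i : Fin (ord g)) → x ∙ g ^ toℕ i ≈ y

  ∙^⇒SameCoset : ∀ {x y} n → x ∙ g ^ n ≈ y → SameCoset x y
  ∙^⇒SameCoset n xgⁿ≈y = let i , gⁱ≈gⁿ = ∈⟨⟩⇒^Fin (^∈⟨⟩ g n) in i , trans (∙-congˡ gⁱ≈gⁿ) xgⁿ≈y

  SameCoset-sym : ∀ {x y} → SameCoset x y → SameCoset y x
  SameCoset-sym {x} {y} (i , xgⁱ≈y) = ∙^⇒SameCoset (toℕ i * ord∸1 g) (begin
    y ∙ g ^ (toℕ i * ord∸1 g)              ≈⟨ ∙-congʳ xgⁱ≈y ⟨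
    x ∙ g ^ toℕ i ∙ g ^ (toℕ i * ord∸1 g)  ≈⟨ assoc x _ _ ⟩
    x ∙ (g ^ toℕ i ∙ g ^ (toℕ i * ord∸1 g)) ≈⟨ ∙-congˡ (^-homo-+ g (toℕ i) _) ⟨
    x ∙ g ^ (toℕ i + toℕ i * ord∸1 g)      ≡⟨ ≡.cong (λ n → x ∙ g ^ n) (*-suc (toℕ i) (ord∸1 g)) ⟨
    x ∙ g ^ (toℕ i * ord g)                ≈⟨ ∙-congˡ (ord∣⇒^≈ε g (n∣m*n (toℕ i))) ⟩
    x ∙ ε                                  ≈⟨ identityʳ x ⟩
    x                                      ∎)

  SameCoset-trans : ∀ {x y z} → SameCoset x y → SameCoset y z → SameCoset x z
  SameCoset-trans {x} {y} {z} (i , xgⁱ≈y) (j , ygʲ≈z) = ∙^⇒SameCoset (toℕ i + toℕ j) (begin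
    x ∙ g ^ (toℕ i + toℕ j)       ≈⟨ ∙-congˡ (^-homo-+ g (toℕ i) (toℕ j)) ⟩
    x ∙ (g ^ toℕ i ∙ g ^ toℕ j)   ≈⟨ assoc x _ _ ⟨
    x ∙ g ^ toℕ i ∙ g ^ toℕ j     ≈⟨ ∙-congʳ xgⁱ≈y ⟩
    y ∙ g ^ toℕ j                 ≈⟨ ygʲ≈z ⟩
    z                             ∎)

  SameCoset? : ∀ x y → Dec (SameCoset x y)
  SameCoset? x y = any? (λ i → x ∙ g ^ toℕ i ≟ y)

  private opaque
    leastRep : ∀ x → ∃ (Least F._<_ (SameCoset x ∘ E.to))
    leastRep x = leastFin (SameCoset? x ∘ E.to)
                          (E.from x , ∙^⇒SameCoset 0 (trans (identityʳ x) (sym (E.strictlyInverseˡ x))))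

  rep : Carrier → Fin size
  rep x = proj₁ (leastRep x)

  rep-SameCoset : ∀ x → SameCoset (E.to (rep x)) x
  rep-SameCoset x = SameCoset-sym (proj₁ (proj₂ (leastRep x)))

  rep-cong : ∀ {x y} → SameCoset x y → rep x ≡ rep y
  rep-cong x∼y = Least-unique (SameCoset-trans (SameCoset-sym x∼y)) (SameCoset-trans x∼y)
                              (proj₂ (leastRep _)) (proj₂ (leastRep _))

  IsRep : Fin size → Set
  IsRep r = rep (E.to r) ≡ r

  rep-IsRep : ∀ x → IsRep (rep x)
  rep-IsRep x = rep-cong (rep-SameCoset x)

  offset : Carrier → Fin (ord g)
  offset x = proj₁ (rep-SameCoset x)

  IsRep? : Decidable IsRep
  IsRep? r = rep (E.to r) F.≟ r

  reps : ℕ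
  reps = count IsRep?

  private
    select-rep : Fin reps → Fin size
    select-rep = select IsRep?

    position : ∀ x → ∃ λ j → select-rep j ≡ rep x
    position x = select-surjective IsRep? (rep-IsRep x)

    decompose : Fin size → Fin reps × Fin (ord g)
    decompose i = proj₁ (position (E.to i)) , offset (E.to i)

    compose : Fin reps × Fin (ord g) → Fin size
    compose (j , k) = E.from (E.to (select-rep j) ∙ g ^ toℕ k)

    decompose-injective : Injective _≡_ _≡_ decompose
    decompose-injective {i} {i′} eq = to-injective (begin
      E.to i                                              ≈⟨ proj₂ (rep-SameCoset (E.to i)) ⟨
      E.to (rep (E.to i)) ∙ g ^ toℕ (offset (E.to i))     ≡⟨ ≡.cong₂ (λ r k → E.to r ∙ g ^ toℕ k)
                                                                     same-rep (≡.cong proj₂ eq) ⟩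
      E.to (rep (E.to i′)) ∙ g ^ toℕ (offset (E.to i′))   ≈⟨ proj₂ (rep-SameCoset (E.to i′)) ⟩
      E.to i′                                             ∎)
      where
      same-rep : rep (E.to i) ≡ rep (E.to i′)
      same-rep = ≡.trans (≡.sym (proj₂ (position (E.to i))))
                         (≡.trans (≡.cong (select-rep ∘ proj₁) eq) (proj₂ (position (E.to i′))))

    compose-injective : Injective _≡_ _≡_ compose
    compose-injective {j , k} {j′ , k′} eq = ≡.cong₂ _,_ j≡j′ k≡k′
      where
      y y′ : Carrier
      y  = E.to (select-rep j)
      y′ = E.to (select-rep j′)

      ygᵏ≈y′gᵏ′ : y ∙ g ^ toℕ k ≈ y′ ∙ g ^ toℕ k′
      ygᵏ≈y′gᵏ′ = from-injective eq

      j≡j′ : j ≡ j′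
      j≡j′ = select-injective IsRep? (≡.trans (≡.sym (select-∈ IsRep? j))
               (≡.trans (rep-cong (SameCoset-trans (k , ygᵏ≈y′gᵏ′) (SameCoset-sym (k′ , refl))))
                        (select-∈ IsRep? j′)))

      k≡k′ : k ≡ k′
      k≡k′ = toℕ-injective (^-injective g (toℕ<n k) (toℕ<n k′)
               (∙-cancelˡ y _ _ (trans ygᵏ≈y′gᵏ′ (∙-congʳ (reflexive (≡.cong (E.to ∘ select-rep) (≡.sym j≡j′)))))))

  size≡reps*ord : size ≡ reps * ord g
  size≡reps*ord = cantor-schröder-bernstein
    (decompose-injective ∘ Injection.injective (Inverse⇒Injection (Sym.inverse *↔×)))
    (Injection.injective (Inverse⇒Injection *↔×) ∘ compose-injective)

  ord∣size : ord g ∣ size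
  ord∣size = divides reps size≡reps*ord

infixr 2 _×ᶠ_
_×ᶠ_ : ∀ {c ℓ c′ ℓ′} → FiniteGroup c ℓ → FiniteGroup c′ ℓ′ → FiniteGroup (c ⊔ c′) (ℓ ⊔ ℓ′)
H ×ᶠ K = record
  { group = FiniteGroup.group H ×ᴳ FiniteGroup.group K
  ; size  = FiniteGroup.size H * FiniteGroup.size K
  ; enum  = ×-size (FiniteGroup.enum H) (FiniteGroup.enum K)
  }

module DirectProduct {c ℓ c′ ℓ′} (H : FiniteGroup c ℓ) (K : FiniteGroup c′ ℓ′) where
  GH : Group c ℓ
  GH = FiniteGroup.group H

  GK : Group c′ ℓ′
  GK = FiniteGroup.group K

  P : Group (c ⊔ c′) (ℓ ⊔ ℓ′)
  P = GH ×ᴳ GK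
  private module P = Group P
  module H  = FiniteGroupProperties H
  module K  = FiniteGroupProperties K
  module HK = FiniteGroupProperties (H ×ᶠ K)

  ^-pair : ∀ h k n → (h , k) HK.^ n ≡ (h H.^ n , k K.^ n)
  ^-pair h k zero    = ≡.refl
  ^-pair h k (suc n) rewrite ^-pair h k n = ≡.refl

  ^ᶻ-pair : ∀ h k z → _^ᶻ_ P (h , k) z ≡ (_^ᶻ_ GH h z , _^ᶻ_ GK k z)
  ^ᶻ-pair h k (+ n)    = ^-pair h k n
  ^ᶻ-pair h k -[1+ n ] = ^-pair (Group._⁻¹ GH h) (Group._⁻¹ GK k) (suc n)

  ∈⟨pair⟩⁻ : ∀ {x y h k} → _∈⟨_⟩ P (x , y) (h , k) → _∈⟨_⟩ GH x h × _∈⟨_⟩ GK y k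
  ∈⟨pair⟩⁻ {h = h} {k} (z , hkᶻ≈xy) with P.trans (P.reflexive (≡.sym (^ᶻ-pair h k z))) hkᶻ≈xy
  ... | hᶻ≈x , kᶻ≈y = (z , hᶻ≈x) , (z , kᶻ≈y)

  ⊆⟨pair⟩⁻ : ∀ {h k h′ k′} → _⊆⟨⟩_ P (h′ , k′) (h , k) → _⊆⟨⟩_ GH h′ h × _⊆⟨⟩_ GK k′ k
  ⊆⟨pair⟩⁻ h′k′⊆hk = let h′∈h , k′∈k = ∈⟨pair⟩⁻ (HK.⊆⟨⟩⇒∈⟨⟩ h′k′⊆hk) in H.∈⟨⟩⇒⊆⟨⟩ h′∈h , K.∈⟨⟩⇒⊆⟨⟩ k′∈k

  ord-pair : ∀ h k → HK.ord (h , k) ≡ lcm (H.ord h) (K.ord k)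
  ord-pair h k = ∣-antisym (HK.^≈ε⇒ord∣ (h , k) hkˡ≈ε) (lcm-least (H.^≈ε⇒ord∣ h (proj₁ hkᵒ≈ε)) (K.^≈ε⇒ord∣ k (proj₂ hkᵒ≈ε)))
    where
    l : ℕ
    l = lcm (H.ord h) (K.ord k)

    hkˡ≈ε : (h , k) HK.^ l P.≈ P.ε
    hkˡ≈ε = P.trans (P.reflexive (^-pair h k l))
                    ( H.ord∣⇒^≈ε h (m∣lcm[m,n] (H.ord h) (K.ord k))
                    , K.ord∣⇒^≈ε k (n∣lcm[m,n] (H.ord h) (K.ord k)) )

    hkᵒ≈ε : (h H.^ HK.ord (h , k) , k K.^ HK.ord (h , k)) P.≈ P.ε
    hkᵒ≈ε = P.trans (P.reflexive (≡.sym (^-pair h k (HK.ord (h , k))))) (HK.^ord≈ε (h , k))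

  module _ {h k} (coprime : Coprime (H.ord h) (K.ord k)) where

    HasCard-pair : HasCard P (h , k) (H.ord h * K.ord k)
    HasCard-pair = ≡.subst (HasCard P (h , k)) (≡.trans (ord-pair h k) (coprime⇒lcm≡* coprime))
                           (HK.HasCard-ord (h , k))

    ∈⟨pair⟩⁺ : ∀ {x y} → _∈⟨_⟩ GH x h → _∈⟨_⟩ GK y k → _∈⟨_⟩ P (x , y) (h , k)
    ∈⟨pair⟩⁺ x∈h y∈k =
      let (_ , xy∈hk) , xy≈xy = injection⇒surjective HasCard-pair (×-size (H.HasCard-ord h) (K.HasCard-ord k))
                                                     projection ((_ , x∈h) , (_ , y∈k))
      in HK.∈⟨⟩-resp-≈ xy≈xy xy∈hk
      where
      projection : Injection (⟨_⟩ₛ P (h , k)) (⟨_⟩ₛ GH h ×ₛ ⟨_⟩ₛ GK k)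
      projection = record
        { to        = λ ((x , y) , xy∈hk) → let x∈h , y∈k = ∈⟨pair⟩⁻ xy∈hk in (x , x∈h) , (y , y∈k)
        ; cong      = id
        ; injective = id
        }

module CoprimeDirectProduct {c ℓ c′ ℓ′} (H : FiniteGroup c ℓ) (K : FiniteGroup c′ ℓ′)
                            (coprime : Coprime (FiniteGroup.size H) (FiniteGroup.size K)) where
  open DirectProduct H K

  ord-coprime : ∀ h k → Coprime (H.ord h) (K.ord k)
  ord-coprime h k (d∣ordh , d∣ordk) =
    coprime (∣-trans d∣ordh (Lagrange.ord∣size H h) , ∣-trans d∣ordk (Lagrange.ord∣size K k))

  ⊆⟨pair⟩⁺ : ∀ {h k h′ k′} → _⊆⟨⟩_ GH h′ h → _⊆⟨⟩_ GK k′ k → _⊆⟨⟩_ P (h′ , k′) (h , k)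
  ⊆⟨pair⟩⁺ {h} {k} h′⊆h k′⊆k (x , y) xy∈h′k′ =
    let x∈h′ , y∈k′ = ∈⟨pair⟩⁻ xy∈h′k′ in ∈⟨pair⟩⁺ (ord-coprime h k) (h′⊆h x x∈h′) (k′⊆k y y∈k′)

  SameCyclic-pair⇔ : ∀ {h k h′ k′} →
                     SameCyclic P (h , k) (h′ , k′) ⇔ (SameCyclic GH h h′ × SameCyclic GK k k′)
  SameCyclic-pair⇔ = mk⇔
    (λ hk≈h′k′ → let h′⊆h , k′⊆k = ⊆⟨pair⟩⁻ (HK.SameCyclic⇒⊇ hk≈h′k′)
                     h⊆h′ , k⊆k′ = ⊆⟨pair⟩⁻ (HK.SameCyclic⇒⊆ hk≈h′k′)
                 in H.⊆⟨⟩-antisym h′⊆h h⊆h′ , K.⊆⟨⟩-antisym k′⊆k k⊆k′)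
    (λ (h≈h′ , k≈k′) → HK.⊆⟨⟩-antisym (⊆⟨pair⟩⁺ (H.SameCyclic⇒⊇ h≈h′) (K.SameCyclic⇒⊇ k≈k′))
                                      (⊆⟨pair⟩⁺ (H.SameCyclic⇒⊆ h≈h′) (K.SameCyclic⇒⊆ k≈k′)))

  Label-pair⇔ : ∀ h k h′ k′ l →
                Label P (h , k) (h′ , k′) l ⇔ (H.ord h * K.ord k ≡ l * (H.ord h′ * K.ord k′))
  Label-pair⇔ h k h′ k′ l = mk⇔ to from
    where
    card-unique : ∀ {h k m} → HasCard P (h , k) m → H.ord h * K.ord k ≡ m
    card-unique {h} {k} = size-unique (HasCard-pair (ord-coprime h k))

    to : Label P (h , k) (h′ , k′) l → H.ord h * K.ord k ≡ l * (H.ord h′ * K.ord k′)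
    to (m , n , m-card , n-card , m≡l*n) =
      ≡.trans (card-unique m-card) (≡.trans m≡l*n (≡.cong (l *_) (≡.sym (card-unique n-card))))

    from : H.ord h * K.ord k ≡ l * (H.ord h′ * K.ord k′) → Label P (h , k) (h′ , k′) l
    from eq = _ , _ , HasCard-pair (ord-coprime h k) , HasCard-pair (ord-coprime h′ k′) , eq

  QPGexcl-edge⇒⨆-edge : ∀ {h k h′ k′} → DiGraph.Edge (QPGexcl P (primeDivisors H)) (h , k) (h′ , k′) →
                        DiGraph.Edge (⨆ (CycSub GH) (QPG GK)) (h , k) (h′ , k′)
  QPGexcl-edge⇒⨆-edge {h} {k} {h′} {k′} ((h′k′⊆hk , hk⊈h′k′) , l , label , l-prime-free) =
    h≈h′ , k′⊆k , k⊈k′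
    where
    open ≡.≡-Reasoning
    h′⊆h : _⊆⟨⟩_ GH h′ h
    h′⊆h = proj₁ (⊆⟨pair⟩⁻ h′k′⊆hk)

    k′⊆k : _⊆⟨⟩_ GK k′ k
    k′⊆k = proj₂ (⊆⟨pair⟩⁻ h′k′⊆hk)

    ordh′∣ordh : H.ord h′ ∣ H.ord h
    ordh′∣ordh = H.∈⟨⟩⇒ord∣ (H.⊆⟨⟩⇒∈⟨⟩ h′⊆h)

    ordk′∣ordk : K.ord k′ ∣ K.ord k
    ordk′∣ordk = K.∈⟨⟩⇒ord∣ (K.⊆⟨⟩⇒∈⟨⟩ k′⊆k)

    a b : ℕ
    a = quotient ordh′∣ordh
    b = quotient ordk′∣ordk

    a*b≡l : a * b ≡ l
    a*b≡l = *-cancelʳ-≡ (a * b) l (H.ord h′ * K.ord k′) (begin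
      a * b * (H.ord h′ * K.ord k′)   ≡⟨ interchange a b (H.ord h′) (K.ord k′) ⟩
      a * H.ord h′ * (b * K.ord k′)   ≡⟨ ≡.cong₂ _*_ (m∣n⇒n≡quotient*m ordh′∣ordh)
                                                     (m∣n⇒n≡quotient*m ordk′∣ordk) ⟨
      H.ord h * K.ord k               ≡⟨ Equivalence.to (Label-pair⇔ h k h′ k′ l) label ⟩
      l * (H.ord h′ * K.ord k′)       ∎)

    a≡1 : a ≡ 1
    a≡1 = no-prime-divisor⇒≡1 λ p-prime p∣a →
      l-prime-free _ (p-prime , ∣-trans p∣a (∣-trans (quotient-∣ ordh′∣ordh) (Lagrange.ord∣size H h)))
                     (∣-trans p∣a (≡.subst (a ∣_) a*b≡l (m∣m*n b)))

    ordh′≡ordh : H.ord h′ ≡ H.ord h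
    ordh′≡ordh = begin
      H.ord h′       ≡⟨ *-identityˡ (H.ord h′) ⟨
      1 * H.ord h′   ≡⟨ ≡.cong (_* H.ord h′) a≡1 ⟨
      a * H.ord h′   ≡⟨ m∣n⇒n≡quotient*m ordh′∣ordh ⟨
      H.ord h        ∎

    h≈h′ : SameCyclic GH h h′
    h≈h′ = H.⊆⟨⟩-antisym h′⊆h (H.⊆⟨⟩∧ord≡⇒⊇ h′⊆h ordh′≡ordh)

    k⊈k′ : ¬ _⊆⟨⟩_ GK k k′
    k⊈k′ k⊆k′ = hk⊈h′k′ (⊆⟨pair⟩⁺ (H.SameCyclic⇒⊆ h≈h′) k⊆k′)

  ⨆-edge⇒QPGexcl-edge : ∀ {h k h′ k′} → DiGraph.Edge (⨆ (CycSub GH) (QPG GK)) (h , k) (h′ , k′) →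
                        DiGraph.Edge (QPGexcl P (primeDivisors H)) (h , k) (h′ , k′)
  ⨆-edge⇒QPGexcl-edge {h} {k} {h′} {k′} (h≈h′ , k′⊆k , k⊈k′) =
    (h′k′⊆hk , hk⊈h′k′) , b , Equivalence.from (Label-pair⇔ h k h′ k′ b) ordhk≡b*ordh′k′ , b-prime-free
    where
    open ≡.≡-Reasoning
    h′k′⊆hk : _⊆⟨⟩_ P (h′ , k′) (h , k)
    h′k′⊆hk = ⊆⟨pair⟩⁺ (H.SameCyclic⇒⊇ h≈h′) k′⊆k

    hk⊈h′k′ : ¬ _⊆⟨⟩_ P (h , k) (h′ , k′)
    hk⊈h′k′ hk⊆h′k′ = k⊈k′ (proj₂ (⊆⟨pair⟩⁻ hk⊆h′k′))

    ordk′∣ordk : K.ord k′ ∣ K.ord k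
    ordk′∣ordk = K.∈⟨⟩⇒ord∣ (K.⊆⟨⟩⇒∈⟨⟩ k′⊆k)

    b : ℕ
    b = quotient ordk′∣ordk

    ordhk≡b*ordh′k′ : H.ord h * K.ord k ≡ b * (H.ord h′ * K.ord k′)
    ordhk≡b*ordh′k′ = begin
      H.ord h * K.ord k           ≡⟨ ≡.cong₂ _*_ (H.SameCyclic⇒ord≡ h≈h′) (m∣n⇒n≡quotient*m ordk′∣ordk) ⟩
      H.ord h′ * (b * K.ord k′)   ≡⟨ x∙yz≈y∙xz (H.ord h′) b (K.ord k′) ⟩
      b * (H.ord h′ * K.ord k′)   ∎

    b-prime-free : ∀ p → primeDivisors H p → ¬ p ∣ b
    b-prime-free p (p-prime , p∣|H|) p∣b = ¬prime[1] (≡.subst Prime (coprime (p∣|H| , p∣|K|)) p-prime)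
      where
      p∣|K| : p ∣ FiniteGroup.size K
      p∣|K| = ∣-trans p∣b (∣-trans (quotient-∣ ordk′∣ordk) (Lagrange.ord∣size K k))

corollary4p2 : ∀ {c ℓ c' ℓ'} (H : FiniteGroup c ℓ) (K : FiniteGroup c' ℓ')
    → Coprime (FiniteGroup.size H) (FiniteGroup.size K)
    → QPGexcl (FiniteGroup.group H ×ᴳ FiniteGroup.group K) (primeDivisors H)
      ≅ᴳ ⨆ (CycSub (FiniteGroup.group H)) (QPG (FiniteGroup.group K))
corollary4p2 H K coprime = record
  { vmap      = record
    { to        = id
    ; from      = id
    ; to-cong   = Equivalence.to SameCyclic-pair⇔
    ; from-cong = Equivalence.from SameCyclic-pair⇔
    ; inverse   = Equivalence.to SameCyclic-pair⇔ , Equivalence.from SameCyclic-pair⇔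
    }
  ; edge-pres = λ _ _ → mk⇔ QPGexcl-edge⇒⨆-edge ⨆-edge⇒QPGexcl-edge
  }
  where open CoprimeDirectProduct H K coprime
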